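{- Let $n\in\mathbb{N}^\ast$ and let $\mathcal{R}$ be the relation on $\mathbb{N}^\ast$ given by $i\,\mathcal{R}\,j\iff\lfloor n/i\rfloor=\lfloor n/j\rfloor$. Then $\mathcal{R}$ is compatible with multiplication: for all $i,j,k\in\mathbb{N}^\ast$, $i\,\mathcal{R}\,j$ implies $ik\,\mathcal{R}\,jk$. Consequently, the formula $\widehat{i}\,\widehat{j}=\widehat{ij}$ (where $\widehat{i}$ denotes the class of $i$) gives a well-defined multiplication on the quotient set $\mathbb{N}^\ast/\mathcal{R}$. -}

module Defs where

open import Data.Nat using (ℕ; NonZero; _/_)
open import Relation.Binary.PropositionalEquality using (_≡_)

R : (n i j : ℕ) → .{{NonZero i}} → .{{NonZero j}} → Set
R n i j = n / i ≡ n / j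

{-# OPTIONS --safe #-}
-- Since ⌊⌊n/i⌋/k⌋ = ⌊n/(ik)⌋, the class of ik is determined by ⌊n/i⌋ and k alone;
-- compatibility on both sides then follows by commutativity of the product.
module Submission where

open import Defs
open import Data.Nat using (ℕ; NonZero; _*_; _/_)
open import Data.Nat.Properties using (m*n≢0; *-comm)
open import Data.Nat.DivMod using (m/n/o≡m/[n*o])
open import Data.Product using (_×_; _,_)
open import Relation.Binary.PropositionalEquality using (_≡_; refl; cong; module ≡-Reasoning)

/-congʳ : (n : ℕ) {a b : ℕ} → .{{_ : NonZero a}} → .{{_ : NonZero b}} → a ≡ b → n / a ≡ n / b
/-congʳ n refl = refl

R-*-comm : (n a b : ℕ) → .{{_ : NonZero a}} → .{{_ : NonZero b}} →
  R n (a * b) (b * a) {{m*n≢0 a b}} {{m*n≢0 b a}}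
R-*-comm n a b = /-congʳ n {{m*n≢0 a b}} {{m*n≢0 b a}} (*-comm a b)

R-*ʳ : (n i j k : ℕ) → .{{_ : NonZero i}} → .{{_ : NonZero j}} → .{{_ : NonZero k}} →
  R n i j → R n (i * k) (j * k) {{m*n≢0 i k}} {{m*n≢0 j k}}
R-*ʳ n i j k i~j = begin
  (n / (i * k)) {{m*n≢0 i k}} ≡⟨ m/n/o≡m/[n*o] n i k {{_}} {{_}} {{m*n≢0 i k}} ⟨
  n / i / k                   ≡⟨ cong (_/ k) i~j ⟩
  n / j / k                   ≡⟨ m/n/o≡m/[n*o] n j k {{_}} {{_}} {{m*n≢0 j k}} ⟩
  (n / (j * k)) {{m*n≢0 j k}} ∎
  where open ≡-Reasoning

R-* : (n i i′ j j′ : ℕ) →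
  .{{_ : NonZero i}} → .{{_ : NonZero i′}} → .{{_ : NonZero j}} → .{{_ : NonZero j′}} →
  R n i i′ → R n j j′ → R n (i * j) (i′ * j′) {{m*n≢0 i j}} {{m*n≢0 i′ j′}}
R-* n i i′ j j′ i~i′ j~j′ = begin
  (n / (i * j)) {{m*n≢0 i j}}     ≡⟨ R-*ʳ n i i′ j i~i′ ⟩
  (n / (i′ * j)) {{m*n≢0 i′ j}}   ≡⟨ R-*-comm n i′ j ⟩
  (n / (j * i′)) {{m*n≢0 j i′}}   ≡⟨ R-*ʳ n j j′ i′ j~j′ ⟩
  (n / (j′ * i′)) {{m*n≢0 j′ i′}} ≡⟨ R-*-comm n j′ i′ ⟩
  (n / (i′ * j′)) {{m*n≢0 i′ j′}} ∎
  where open ≡-Reasoning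

proposition2 : (n : ℕ) → .{{NonZero n}} →
    ((i j k : ℕ) → .{{_ : NonZero i}} → .{{_ : NonZero j}} → .{{_ : NonZero k}} →
      R n i j → R n (i * k) (j * k) {{m*n≢0 i k}} {{m*n≢0 j k}})
    × ((i i′ j j′ : ℕ) → .{{_ : NonZero i}} → .{{_ : NonZero i′}} → .{{_ : NonZero j}} → .{{_ : NonZero j′}} →
      R n i i′ → R n j j′ → R n (i * j) (i′ * j′) {{m*n≢0 i j}} {{m*n≢0 i′ j′}})
proposition2 n = R-*ʳ n , R-* n
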